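{- Fix a positive integer $t$. If $G$ is a finite graph with $g_o(G)\ge 2t+1$ and $\mathrm{mad}(G)<2+\frac{1}{3t-2}$, then $\chi_c(G)\le 2+\frac1t$.
   Context: Graphs are finite and simple. $g_o(G)$ is the length of a shortest odd cycle in $G$ ($g_o(G)=\infty$ if $G$ is bipartite). $\mathrm{mad}(G)=\max_{H\subseteq G}\frac{2|E(H)|}{|V(H)|}$, the maximum over nonempty subgraphs $H$. For integers $p\ge 2q\ge 2$, a $(p,q)$-coloring of $G$ is a map $\phi:V(G)\to\{0,1,\dots,p-1\}$ such that $q\le|\phi(u)-\phi(v)|\le p-q$ for every edge $uv$. The circular chromatic number is $\chi_c(G)=\inf\{p/q: G \text{ has a } (p,q)\text{ -coloring}\}$. -}

module Defs where

open import Data.Nat using (ℕ; zero; suc; _+_; _*_; _∸_; _≤_; _<_; _<ᵇ_; ∣_-_∣)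
open import Data.Bool using (Bool; true; false; _∧_; if_then_else_)
open import Data.Fin using (Fin; zero; suc; toℕ; inject₁; fromℕ)
open import Data.List using (List; map; allFin)
open import Data.Nat.ListAction using (sum)
open import Data.Product using (Σ; _×_; _,_; ∃)
open import Function.Definitions using (Injective)
open import Relation.Binary.PropositionalEquality using (_≡_)

record Graph : Set where
  field
    n      : ℕ
    adj    : Fin n → Fin n → Bool
    sym    : ∀ i j → adj i j ≡ adj j i
    irrefl : ∀ i → adj i i ≡ false
open Graph public

Adj : (G : Graph) → Fin (n G) → Fin (n G) → Set
Adj G u v = adj G u v ≡ true

∣V∣ : Graph → ℕ
∣V∣ G = n G

∣E∣ : Graph → ℕ
∣E∣ G = sum (map (λ i → sum (map (λ j →
          if (adj G i j ∧ (toℕ i <ᵇ toℕ j)) then 1 else 0) (allFin (n G)))) (allFin (n G)))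

_⊆G_ : Graph → Graph → Set
H ⊆G G = Σ (Fin (n H) → Fin (n G)) λ f →
           Injective _≡_ _≡_ f × (∀ u v → Adj H u v → Adj G (f u) (f v))

record Cycle (G : Graph) (k : ℕ) : Set where
  field
    m       : ℕ
    len     : k ≡ suc m
    long    : 3 ≤ k
    c       : Fin (suc m) → Fin (n G)
    inj     : Injective _≡_ _≡_ c
    step    : ∀ (i : Fin m) → Adj G (c (inject₁ i)) (c (suc i))
    closing : Adj G (c (fromℕ m)) (c zero)

Odd : ℕ → Set
Odd k = ∃ λ j → k ≡ suc (2 * j)

-- g_o(G) ≥ g : every odd cycle has length at least g (vacuous if G is bipartite,
-- matching the convention g_o = ∞).
OddGirth≥ : Graph → ℕ → Set
OddGirth≥ G g = ∀ k → Odd k → Cycle G k → g ≤ k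

-- mad(G) < a / b  (b > 0): for every nonempty subgraph H, 2|E(H)|/|V(H)| < a/b,
-- i.e. 2|E(H)| * b < a * |V(H)|.
MadLt : Graph → ℕ → ℕ → Set
MadLt G a b = ∀ (H : Graph) → H ⊆G G → 1 ≤ ∣V∣ H → 2 * ∣E∣ H * b < a * ∣V∣ H

IsPQColoring : (G : Graph) (p q : ℕ) → (Fin (n G) → Fin p) → Set
IsPQColoring G p q φ = ∀ u v → Adj G u v →
  (q ≤ ∣ toℕ (φ u) - toℕ (φ v) ∣) × (∣ toℕ (φ u) - toℕ (φ v) ∣ ≤ p ∸ q)

HasPQColoring : Graph → ℕ → ℕ → Set
HasPQColoring G p q = 2 ≤ 2 * q × 2 * q ≤ p × Σ (Fin (n G) → Fin p) (IsPQColoring G p q)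

-- χ_c(G) ≤ a / b  (b > 0), with χ_c the infimum of p/q over (p,q)-colorings:
-- for every rational r = x/y > a/b (y > 0) there is a (p,q)-coloring with p/q < r.
ChiCLe : Graph → ℕ → ℕ → Set
ChiCLe G a b = ∀ (x y : ℕ) → 1 ≤ y → a * y < x * b →
  Σ ℕ λ p → Σ ℕ λ q → HasPQColoring G p q × p * y < x * q

-- Induction over the subgraphs of G, colouring with the circular clique on the colours 0, …, 2t,
-- where a and b are adjacent iff t ≤ |a − b| ≤ t + 1. A vertex of degree at most 1 is reducible.
-- So is a thread of 2t − 1 consecutive degree-2 vertices: delete its interior, colour the rest, and
-- recolour the interior along a walk of length exactly 2t between the colours of its ends, which
-- exists for any two colours. If the thread closes up into a cycle, that cycle has length at most
-- 2t, hence is even by the odd-girth hypothesis and is recoloured by a closed walk. In a graph with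
-- neither configuration every vertex has degree at least 2 and every thread is shorter. Writing
-- in(v) and out(v) for the total length of the threads entering and leaving v, and b = 3t − 2,
-- one checks 2(2b + 1) + out(v) ≤ 2b·deg(v) + in(v), with equality at degree-2 vertices, where
-- in(v) = out(v) + 2. Summing over v, in and out cancel and 2|E| / |V| ≥ 2 + 1/b, contradicting
-- the bound on mad(G).

module Submission where

open import Defs renaming (sym to adj-sym)
open import Data.Nat using (ℕ; zero; suc; _+_; _*_; _∸_; _≤_; _<_; _≤?_; _≟_; _<ᵇ_; ∣_-_∣; z≤n; s≤s)
open import Data.Nat.Properties
open import Data.Nat.GeneralisedArithmetic using (fold; fold-+)
open import Data.Nat.Tactic.RingSolver using (solve-∀)
open import Algebra.Properties.Semiring.Sum +-*-semiring
  using (sum; ∑-distrib-+; ∑-comm; *-distribˡ-sum; sum-cong-≗; sum-replicate-zero)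
import Data.Nat.ListAction as List
open import Data.Bool using (Bool; true; false; not; _∧_; _∨_; if_then_else_)
import Data.Bool as Bool
open import Data.Bool.Properties using (not-injective)
open import Data.Fin using (Fin; zero; suc; toℕ; fromℕ<; fromℕ; inject₁)
import Data.Fin.Properties as Fin
open import Data.List using (map; allFin; tabulate)
open import Data.List.Properties using (map-tabulate)
open import Data.Product using (∃; ∃₂; _×_; _,_; proj₁; proj₂)
open import Data.Sum using (_⊎_; inj₁; inj₂)
open import Data.Empty using (⊥; ⊥-elim)
open import Function using (_∘_; id; case_of_)
open import Relation.Binary.PropositionalEquality
open import Relation.Binary using (tri<; tri≈; tri>)
open import Relation.Nullary using (¬_; Dec; yes; no; does; ¬?; _×-dec_)
open import Relation.Nullary.Decidable using (dec-true; dec-false)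

sum-mono-≤ : ∀ {n} {f g : Fin n → ℕ} → (∀ i → f i ≤ g i) → sum f ≤ sum g
sum-mono-≤ {zero}  _   = z≤n
sum-mono-≤ {suc n} f≤g = +-mono-≤ (f≤g zero) (sum-mono-≤ (f≤g ∘ suc))

sum-const : ∀ n c → sum {n} (λ _ → c) ≡ n * c
sum-const zero    c = refl
sum-const (suc n) c = cong (c +_) (sum-const n c)

listSum-tabulate : ∀ {n} (f : Fin n → ℕ) → List.sum (tabulate f) ≡ sum f
listSum-tabulate {zero}  f = refl
listSum-tabulate {suc n} f = cong (f zero +_) (listSum-tabulate (f ∘ suc))

listSum-allFin : ∀ {n} (f : Fin n → ℕ) → List.sum (map f (allFin n)) ≡ sum f
listSum-allFin {n} f = trans (cong List.sum (map-tabulate id f)) (listSum-tabulate f)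

true-or-false : ∀ b → b ≡ true ⊎ b ≡ false
true-or-false true  = inj₁ refl
true-or-false false = inj₂ refl

_≡ᵇ_ : ∀ {n} → Fin n → Fin n → Bool
x ≡ᵇ y = does (x Fin.≟ y)

≡ᵇ-refl : ∀ {n} (x : Fin n) → (x ≡ᵇ x) ≡ true
≡ᵇ-refl x = dec-true (x Fin.≟ x) refl

≡ᵇ-true⇒≡ : ∀ {n} {x y : Fin n} → (x ≡ᵇ y) ≡ true → x ≡ y
≡ᵇ-true⇒≡ {x = x} {y} eq with x Fin.≟ y
... | yes x≡y = x≡y

sumWhere : ∀ {n} → (Fin n → Bool) → (Fin n → ℕ) → ℕ
sumWhere P g = sum λ x → if P x then g x else 0

count : ∀ {n} → (Fin n → Bool) → ℕ
count P = sumWhere P (λ _ → 1)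

module _ {n : ℕ} where

  sumWhere-cong : {P Q : Fin n → Bool} (g : Fin n → ℕ) → (∀ x → P x ≡ Q x) → sumWhere P g ≡ sumWhere Q g
  sumWhere-cong g P≗Q = sum-cong-≗ λ x → cong (λ b → if b then g x else 0) (P≗Q x)

  sumWhere-zero : {P : Fin n → Bool} {g : Fin n → ℕ} → (∀ x → P x ≡ true → g x ≡ 0) → sumWhere P g ≡ 0
  sumWhere-zero {P} {g} g≡0 = trans (sum-cong-≗ pointwise) (sum-replicate-zero n)
    where
    pointwise : ∀ x → (if P x then g x else 0) ≡ 0
    pointwise x with P x in Px
    ... | true  = g≡0 x Px
    ... | false = refl

  sumWhere-mono : {P Q : Fin n → Bool} (g : Fin n → ℕ) → (∀ x → P x ≡ true → Q x ≡ true) →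
                  sumWhere P g ≤ sumWhere Q g
  sumWhere-mono {P} {Q} g P⊆Q = sum-mono-≤ pointwise
    where
    pointwise : ∀ x → (if P x then g x else 0) ≤ (if Q x then g x else 0)
    pointwise x with P x in Px
    ... | false = z≤n
    ... | true rewrite P⊆Q x Px = ≤-refl

  sumWhere-∨ : {P Q : Fin n → Bool} (g : Fin n → ℕ) → (∀ x → P x ≡ true → Q x ≡ false) →
               sumWhere (λ x → P x ∨ Q x) g ≡ sumWhere P g + sumWhere Q g
  sumWhere-∨ {P} {Q} g disjoint = trans (sum-cong-≗ pointwise)
    (∑-distrib-+ (λ x → if P x then g x else 0) (λ x → if Q x then g x else 0))
    where
    pointwise : ∀ x → (if P x ∨ Q x then g x else 0) ≡ (if P x then g x else 0) + (if Q x then g x else 0)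
    pointwise x with P x in Px
    ... | true rewrite disjoint x Px = sym (+-identityʳ (g x))
    ... | false = refl

  sumWhere-≤ : {P : Fin n → Bool} (g : Fin n → ℕ) (B : ℕ) → (∀ x → P x ≡ true → g x ≤ B) →
               sumWhere P g ≤ B * count P
  sumWhere-≤ {P} g B g≤B =
    subst (sumWhere P g ≤_) (sym (*-distribˡ-sum B (λ x → if P x then 1 else 0))) (sum-mono-≤ pointwise)
    where
    pointwise : ∀ x → (if P x then g x else 0) ≤ B * (if P x then 1 else 0)
    pointwise x with P x in Px
    ... | true  = subst (g x ≤_) (sym (*-identityʳ B)) (g≤B x Px)
    ... | false = z≤n

count-all : ∀ n → count {n} (λ _ → true) ≡ n
count-all n = trans (sum-const n 1) (*-identityʳ n)

sumWhere-≡ᵇ : ∀ {n} (a : Fin n) (g : Fin n → ℕ) → sumWhere (_≡ᵇ a) g ≡ g a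
sumWhere-≡ᵇ {suc n} zero    g = trans (cong (g zero +_) (sum-replicate-zero n)) (+-identityʳ (g zero))
sumWhere-≡ᵇ {suc n} (suc a) g = sumWhere-≡ᵇ a (g ∘ suc)

module _ {n : ℕ} {a b : Fin n} (a≢b : a ≢ b) where

  ≡ᵇ-disjoint : ∀ x → (x ≡ᵇ a) ≡ true → (x ≡ᵇ b) ≡ false
  ≡ᵇ-disjoint x x≡a = dec-false (x Fin.≟ b) (a≢b ∘ trans (sym (≡ᵇ-true⇒≡ x≡a)))

  sumWhere-pair : (g : Fin n → ℕ) → sumWhere (λ x → (x ≡ᵇ a) ∨ (x ≡ᵇ b)) g ≡ g a + g b
  sumWhere-pair g = trans (sumWhere-∨ g ≡ᵇ-disjoint) (cong₂ _+_ (sumWhere-≡ᵇ a g) (sumWhere-≡ᵇ b g))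

module _ {n : ℕ} (P : Fin n → Bool) where

  count-pos⇒∃ : 1 ≤ count P → ∃ λ x → P x ≡ true
  count-pos⇒∃ 1≤count with Fin.any? (λ x → P x Bool.≟ true)
  ... | yes witness = witness
  ... | no none = ⊥-elim (1+n≰n (subst (1 ≤_) (sumWhere-zero absurd) 1≤count))
    where
    absurd : ∀ x → P x ≡ true → 1 ≡ 0
    absurd x Px = ⊥-elim (none (x , Px))

  count≥2 : {a b : Fin n} → a ≢ b → P a ≡ true → P b ≡ true → 2 ≤ count P
  count≥2 {a} {b} a≢b Pa Pb =
    subst (_≤ count P) (sumWhere-pair a≢b (λ _ → 1)) (sumWhere-mono (λ _ → 1) pair⊆P)
    where
    pair⊆P : ∀ x → (x ≡ᵇ a) ∨ (x ≡ᵇ b) ≡ true → P x ≡ true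
    pair⊆P x hit with x Fin.≟ a | x Fin.≟ b
    pair⊆P x hit | yes refl | _ = Pa
    pair⊆P x hit | no _ | yes refl = Pb

  count≥3 : {a b c : Fin n} → a ≢ b → a ≢ c → b ≢ c →
            P a ≡ true → P b ≡ true → P c ≡ true → 3 ≤ count P
  count≥3 {a} {b} {c} a≢b a≢c b≢c Pa Pb Pc = subst (_≤ count P) triple≡3 (sumWhere-mono (λ _ → 1) triple⊆P)
    where
    pair : Fin n → Bool
    pair x = (x ≡ᵇ a) ∨ (x ≡ᵇ b)
    pair-misses-c : ∀ x → pair x ≡ true → (x ≡ᵇ c) ≡ false
    pair-misses-c x hit with x Fin.≟ a | x Fin.≟ b
    ... | yes refl | _ = ≡ᵇ-disjoint a≢c a (≡ᵇ-refl a)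
    ... | no _ | yes refl = ≡ᵇ-disjoint b≢c b (≡ᵇ-refl b)
    triple≡3 : count (λ x → pair x ∨ (x ≡ᵇ c)) ≡ 3
    triple≡3 = trans (sumWhere-∨ _ pair-misses-c) (cong₂ _+_ (sumWhere-pair a≢b _) (sumWhere-≡ᵇ c _))
    triple⊆P : ∀ x → pair x ∨ (x ≡ᵇ c) ≡ true → P x ≡ true
    triple⊆P x hit with x Fin.≟ a | x Fin.≟ b | x Fin.≟ c
    ... | yes refl | _ | _ = Pa
    ... | no _ | yes refl | _ = Pb
    ... | no _ | no _ | yes refl = Pc

  count≥2⇒another : 2 ≤ count P → {a : Fin n} → P a ≡ true → ∃ λ b → P b ≡ true × b ≢ a
  count≥2⇒another 2≤count {a} Pa with Fin.any? (λ b → (P b Bool.≟ true) ×-dec ¬? (b Fin.≟ a))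
  ... | yes another = another
  ... | no none = ⊥-elim (1+n≰n (≤-trans 2≤count (subst (count P ≤_) (sumWhere-≡ᵇ a _) (sumWhere-mono _ P⊆a))))
    where
    P⊆a : ∀ x → P x ≡ true → (x ≡ᵇ a) ≡ true
    P⊆a x Px with x Fin.≟ a
    ... | yes _   = refl
    ... | no x≢a = ⊥-elim (none (x , Px , x≢a))

  count≤1⇒unique : count P ≤ 1 → {a x : Fin n} → P a ≡ true → P x ≡ true → x ≡ a
  count≤1⇒unique count≤1 {a} {x} Pa Px with x Fin.≟ a
  ... | yes x≡a = x≡a
  ... | no x≢a  = ⊥-elim (1+n≰n (≤-trans (count≥2 x≢a Px Pa) count≤1))

  count≤2⇒pair : count P ≤ 2 → {a b x : Fin n} → a ≢ b → P a ≡ true → P b ≡ true → P x ≡ true →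
                 x ≡ a ⊎ x ≡ b
  count≤2⇒pair count≤2 {a} {b} {x} a≢b Pa Pb Px with x Fin.≟ a | x Fin.≟ b
  ... | yes x≡a | _       = inj₁ x≡a
  ... | no _    | yes x≡b = inj₂ x≡b
  ... | no x≢a  | no x≢b  =
    ⊥-elim (1+n≰n (≤-trans (count≥3 a≢b (x≢a ∘ sym) (x≢b ∘ sym) Pa Pb Px) count≤2))

  sumWhere-two : {a b : Fin n} (g : Fin n → ℕ) → a ≢ b → P a ≡ true → P b ≡ true →
                 (∀ x → P x ≡ true → x ≡ a ⊎ x ≡ b) → sumWhere P g ≡ g a + g b
  sumWhere-two {a} {b} g a≢b Pa Pb only-a-b = trans (sumWhere-cong g P≗pair) (sumWhere-pair a≢b g)
    where
    P≗pair : ∀ x → P x ≡ (x ≡ᵇ a) ∨ (x ≡ᵇ b)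
    P≗pair x with x Fin.≟ a | x Fin.≟ b
    ... | yes refl | _ = Pa
    ... | no _ | yes refl = Pb
    ... | no x≢a | no x≢b with P x in Px
    ...   | false = refl
    ...   | true with only-a-b x Px
    ...     | inj₁ x≡a = ⊥-elim (x≢a x≡a)
    ...     | inj₂ x≡b = ⊥-elim (x≢b x≡b)

  count<n : {v : Fin n} → P v ≡ false → count P < n
  count<n {v} Pv = subst (_≤ n) (+-comm (count P) 1) (begin
    count P + 1                        ≡⟨ cong (count P +_) (sym (sumWhere-≡ᵇ v _)) ⟩
    count P + count (_≡ᵇ v)            ≡⟨ sym (sumWhere-∨ _ misses-v) ⟩
    count (λ x → P x ∨ (x ≡ᵇ v))       ≤⟨ sumWhere-mono {n} {Q = λ _ → true} (λ _ → 1) (λ _ _ → refl) ⟩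
    count {n} (λ _ → true)             ≡⟨ count-all n ⟩
    n                                  ∎)
    where
    open ≤-Reasoning
    misses-v : ∀ x → P x ≡ true → (x ≡ᵇ v) ≡ false
    misses-v x Px = dec-false (x Fin.≟ v) λ { refl → case trans (sym Pv) Px of λ () }

degree : (G : Graph) → Fin (n G) → ℕ
degree G v = count (adj G v)

exactly-one-<ᵇ : ∀ m k → m ≢ k → (if m <ᵇ k then 1 else 0) + (if k <ᵇ m then 1 else 0) ≡ 1
exactly-one-<ᵇ zero    zero    m≢k = ⊥-elim (m≢k refl)
exactly-one-<ᵇ zero    (suc k) _   = refl
exactly-one-<ᵇ (suc m) zero    _   = refl
exactly-one-<ᵇ (suc m) (suc k) m≢k = exactly-one-<ᵇ m k (m≢k ∘ cong suc)

adj-irreflexive : (G : Graph) {u v : Fin (n G)} → Adj G u v → u ≢ v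
adj-irreflexive G {u} uv refl with trans (sym uv) (irrefl G u)
... | ()

adj-symmetric : (G : Graph) {u v : Fin (n G)} → Adj G u v → Adj G v u
adj-symmetric G {u} {v} uv = trans (adj-sym G v u) uv

module _ (G : Graph) where

  private
    ordered : Fin (n G) → Fin (n G) → ℕ
    ordered i j = if adj G i j ∧ (toℕ i <ᵇ toℕ j) then 1 else 0

    ∣E∣-as-sum : ∣E∣ G ≡ sum λ i → sum (ordered i)
    ∣E∣-as-sum = trans (listSum-allFin λ i → List.sum (map (ordered i) (allFin (n G))))
      (sum-cong-≗ λ i → listSum-allFin (ordered i))

    adjacency-split : ∀ i j → (if adj G i j then 1 else 0) ≡ ordered i j + ordered j i
    adjacency-split i j rewrite adj-sym G j i with adj G i j in ij
    ... | false = refl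
    ... | true  = sym (exactly-one-<ᵇ (toℕ i) (toℕ j) (adj-irreflexive G ij ∘ Fin.toℕ-injective))

  handshake : 2 * ∣E∣ G ≡ sum (degree G)
  handshake = begin
    2 * ∣E∣ G                                           ≡⟨ cong (2 *_) ∣E∣-as-sum ⟩
    E + (E + 0)                                         ≡⟨ cong (E +_) (+-identityʳ E) ⟩
    E + E                                               ≡⟨ cong (E +_) (∑-comm ordered) ⟩
    E + sum (λ i → sum λ j → ordered j i)               ≡⟨ ∑-distrib-+ (λ i → sum (ordered i)) _ ⟨
    sum (λ i → sum (ordered i) + sum λ j → ordered j i) ≡⟨ sum-cong-≗ (λ i → ∑-distrib-+ (ordered i) _) ⟨
    sum (λ i → sum λ j → ordered i j + ordered j i)
      ≡⟨ sum-cong-≗ (λ i → sum-cong-≗ (adjacency-split i)) ⟨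
    sum (degree G)                                      ∎
    where
    open ≡-Reasoning
    E = sum λ i → sum (ordered i)

degree2-neighbours : (H : Graph) {v : Fin (n H)} → degree H v ≡ 2 →
                     ∃₂ λ a b → a ≢ b × Adj H v a × Adj H v b × (∀ x → Adj H v x → x ≡ a ⊎ x ≡ b)
degree2-neighbours H {v} deg≡2 with count-pos⇒∃ (adj H v) (subst (1 ≤_) (sym deg≡2) (s≤s z≤n))
... | a , va with count≥2⇒another (adj H v) (≤-reflexive (sym deg≡2)) va
...   | b , vb , b≢a =
  a , b , b≢a ∘ sym , va , vb , λ x → count≤2⇒pair (adj H v) (≤-reflexive deg≡2) (b≢a ∘ sym) va vb

⊆-refl : (G : Graph) → G ⊆G G
⊆-refl G = id , id , λ _ _ → id

⊆-trans : {A B C : Graph} → A ⊆G B → B ⊆G C → A ⊆G C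
⊆-trans (f , f-inj , f-adj) (g , g-inj , g-adj) = g ∘ f , f-inj ∘ g-inj , λ u v → g-adj (f u) (f v) ∘ f-adj u v

cycle-⊆ : {H G : Graph} {k : ℕ} → H ⊆G G → Cycle H k → Cycle G k
cycle-⊆ (f , f-inj , f-adj) C = record
  { m = m ; len = len ; long = long ; c = f ∘ c ; inj = inj ∘ f-inj
  ; step = λ i → f-adj _ _ (step i) ; closing = f-adj _ _ closing }
  where open Cycle C

oddGirth-⊆ : {H G : Graph} {g : ℕ} → H ⊆G G → OddGirth≥ G g → OddGirth≥ H g
oddGirth-⊆ H⊆G girth k odd = girth k odd ∘ cycle-⊆ H⊆G

record Enumeration {n : ℕ} (keep : Fin n → Bool) : Set where
  field
    size       : ℕ
    index      : Fin size → Fin n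
    index-inj  : ∀ {i j} → index i ≡ index j → i ≡ j
    index-onto : ∀ v → keep v ≡ true → ∃ λ i → index i ≡ v
    size≡count : size ≡ count keep

private
  counted-first : ∀ {n} → (Fin (suc n) → Bool) → Bool → ℕ
  counted-first keep b = (if b then 1 else 0) + count (keep ∘ suc)

enumerate : ∀ {n} (keep : Fin n → Bool) → Enumeration keep
enumerate {zero} keep = record
  { size = 0 ; index = λ () ; index-inj = λ {} ; index-onto = λ () ; size≡count = refl }
enumerate {suc n} keep with enumerate (keep ∘ suc) | keep zero in keep0
... | E | true = record
  { size = suc size ; index = index′ ; index-inj = inj′ ; index-onto = onto′
  ; size≡count = trans (cong suc size≡count) (cong (counted-first keep) (sym keep0)) }
  where
  open Enumeration E
  index′ : Fin (suc size) → Fin (suc n)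
  index′ zero    = zero
  index′ (suc i) = suc (index i)
  inj′ : ∀ {i j} → index′ i ≡ index′ j → i ≡ j
  inj′ {zero}  {zero}  _  = refl
  inj′ {suc i} {suc j} eq = cong suc (index-inj (Fin.suc-injective eq))
  onto′ : ∀ v → keep v ≡ true → ∃ λ i → index′ i ≡ v
  onto′ zero    _    = zero , refl
  onto′ (suc v) kept = let i , eq = index-onto v kept in suc i , cong suc eq
... | E | false = record
  { size = size ; index = suc ∘ index ; index-inj = index-inj ∘ Fin.suc-injective
  ; index-onto = onto′ ; size≡count = trans size≡count (cong (counted-first keep) (sym keep0)) }
  where
  open Enumeration E
  onto′ : ∀ v → keep v ≡ true → ∃ λ i → suc (index i) ≡ v
  onto′ zero    kept with trans (sym keep0) kept
  ... | ()
  onto′ (suc v) kept = let i , eq = index-onto v kept in i , cong suc eq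

induced : (H : Graph) → (Fin (n H) → Bool) → Graph
induced H keep = record
  { n = size ; adj = λ i j → adj H (index i) (index j)
  ; sym = λ i j → adj-sym H (index i) (index j) ; irrefl = irrefl H ∘ index }
  where open Enumeration (enumerate keep)

induced-⊆ : (H : Graph) (keep : Fin (n H) → Bool) → induced H keep ⊆G H
induced-⊆ H keep = index , index-inj , λ _ _ → id
  where open Enumeration (enumerate keep)

induced-smaller : (H : Graph) {keep : Fin (n H) → Bool} {v : Fin (n H)} → keep v ≡ false →
                  n (induced H keep) < n H
induced-smaller H {keep} dropped = subst (_< n H) (sym size≡count) (count<n keep dropped)
  where open Enumeration (enumerate keep)

-- The circular clique

module CircularClique (t : ℕ) where

  Colour : ℕ → Set
  Colour a = a ≤ t + t

  record _~_ (a b : ℕ) : Set where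
    constructor adjacent
    field
      far  : t ≤ ∣ a - b ∣
      near : ∣ a - b ∣ ≤ (2 * t + 1) ∸ t

  2t+1∸t≡1+t : (2 * t + 1) ∸ t ≡ suc t
  2t+1∸t≡1+t = begin
    (2 * t + 1) ∸ t   ≡⟨ cong (λ s → (t + s + 1) ∸ t) (+-identityʳ t) ⟩
    (t + t + 1) ∸ t   ≡⟨ cong (_∸ t) (+-assoc t t 1) ⟩
    (t + (t + 1)) ∸ t ≡⟨ m+n∸m≡n t (t + 1) ⟩
    t + 1             ≡⟨ +-comm t 1 ⟩
    suc t             ∎
    where open ≡-Reasoning

  ~-sym : ∀ {a b} → a ~ b → b ~ a
  ~-sym {a} {b} (adjacent far near) =
    adjacent (subst (t ≤_) (∣-∣-comm a b) far) (subst (_≤ (2 * t + 1) ∸ t) (∣-∣-comm a b) near)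

  distance-t⇒~ : ∀ {a b} → ∣ a - b ∣ ≡ t → a ~ b
  distance-t⇒~ d≡t = adjacent (≤-reflexive (sym d≡t))
    (subst₂ _≤_ (sym d≡t) (sym 2t+1∸t≡1+t) (n≤1+n t))

  distance-1+t⇒~ : ∀ {a b} → ∣ a - b ∣ ≡ suc t → a ~ b
  distance-1+t⇒~ d≡1+t = adjacent (subst (t ≤_) (sym d≡1+t) (n≤1+n t))
    (≤-reflexive (trans d≡1+t (sym 2t+1∸t≡1+t)))

  -- Adding t modulo 2t + 1.
  hop : ℕ → ℕ
  hop a with a ≤? t
  ... | yes _ = a + t
  ... | no  _ = a ∸ suc t

  hop-low : ∀ {a} → a ≤ t → hop a ≡ a + t
  hop-low {a} a≤t with a ≤? t
  ... | yes _   = refl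
  ... | no  a≰t = ⊥-elim (a≰t a≤t)

  hop-high : ∀ x → hop (suc t + x) ≡ x
  hop-high x with suc t + x ≤? t
  ... | yes a≤t = ⊥-elim (1+n≰n (≤-trans (m≤m+n (suc t) x) a≤t))
  ... | no  _   = m+n∸m≡n (suc t) x

  low-or-high : ∀ a → a ≤ t ⊎ ∃ λ x → a ≡ suc t + x
  low-or-high a with a ≤? t
  ... | yes a≤t = inj₁ a≤t
  ... | no  a≰t = inj₂ (a ∸ suc t , sym (m+[n∸m]≡n (≰⇒> a≰t)))

  hop-colour : ∀ {a} → Colour a → Colour (hop a)
  hop-colour {a} a≤2t with low-or-high a
  ... | inj₁ a≤t        rewrite hop-low a≤t = +-monoˡ-≤ t a≤t
  ... | inj₂ (x , refl) rewrite hop-high x  = ≤-trans (m≤n+m x (suc t)) a≤2t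

  hop-~ : ∀ a → a ~ hop a
  hop-~ a with low-or-high a
  ... | inj₁ a≤t        rewrite hop-low a≤t = distance-t⇒~ (∣m-m+n∣≡n a t)
  ... | inj₂ (x , refl) rewrite hop-high x  =
    distance-1+t⇒~ (trans (∣-∣-comm (suc t + x) x)
                     (trans (cong (∣ x -_∣) (+-comm (suc t) x)) (∣m-m+n∣≡n x (suc t))))

  back : ℕ → ℕ
  back zero    = t + t
  back (suc a) = a

  hop-hop : ∀ {a} → Colour a → hop (hop a) ≡ back a
  hop-hop {zero} _ rewrite hop-low {zero} z≤n | hop-low {t} ≤-refl = refl
  hop-hop {suc a} a≤2t with low-or-high (suc a)
  ... | inj₁ a<t rewrite hop-low a<t = trans (cong (hop ∘ suc) (+-comm a t)) (hop-high a)
  ... | inj₂ (x , a≡) = begin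
    hop (hop (suc a))       ≡⟨ cong (hop ∘ hop) a≡ ⟩
    hop (hop (suc t + x))   ≡⟨ cong hop (hop-high x) ⟩
    hop x                   ≡⟨ hop-low x≤t ⟩
    x + t                   ≡⟨ +-comm x t ⟩
    t + x                   ≡⟨ suc-injective a≡ ⟨
    a                       ∎
    where
    open ≡-Reasoning
    x≤t : x ≤ t
    x≤t = <⇒≤ (+-cancelˡ-< t x t (subst (_≤ t + t) a≡ a≤2t))

  fold-hop-colour : ∀ k {a} → Colour a → Colour (fold a hop k)
  fold-hop-colour zero    a-col = a-col
  fold-hop-colour (suc k) a-col = hop-colour (fold-hop-colour k a-col)

  fold-hop-even : ∀ j {a} → Colour a → fold a hop (j + j) ≡ fold a back j
  fold-hop-even zero    _ = refl
  fold-hop-even (suc j) {a} a-col = begin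
    hop (fold a hop (j + suc j)) ≡⟨ cong (λ k → hop (fold a hop k)) (+-suc j j) ⟩
    hop (hop (fold a hop (j + j))) ≡⟨ hop-hop (fold-hop-colour (j + j) a-col) ⟩
    back (fold a hop (j + j))      ≡⟨ cong back (fold-hop-even j a-col) ⟩
    back (fold a back j)           ∎
    where open ≡-Reasoning

  fold-back : ∀ d a → d ≤ a → fold a back d ≡ a ∸ d
  fold-back zero    a       _         = refl
  fold-back (suc d) (suc a) (s≤s d≤a) = begin
    fold (suc a) back (suc d)   ≡⟨ cong (λ k → fold (suc a) back k) (+-comm 1 d) ⟩
    fold (suc a) back (d + 1)   ≡⟨ fold-+ (suc a) back d ⟩
    fold a back d               ≡⟨ fold-back d a d≤a ⟩
    a ∸ d                       ∎
    where open ≡-Reasoning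

  WithinT : ℕ → ℕ → Set
  WithinT a b = ∃ λ j → j ≤ t × fold a back j ≡ b

  within-t-ordered : ∀ {a b} → b ≤ a → Colour a → WithinT a b ⊎ WithinT b a
  within-t-ordered {a} {b} b≤a a≤2t with (a ∸ b) ≤? t
  ... | yes a-b≤t = inj₁ (a ∸ b , a-b≤t , trans (fold-back (a ∸ b) a (m∸n≤m a b)) (m∸[m∸n]≡n b≤a))
  ... | no  a-b≰t = inj₂ (f + suc b , j≤t , wraps)
    where
    e = a ∸ b ∸ suc t
    f = t + t ∸ a
    2t≡a+f : t + t ≡ a + f
    2t≡a+f = sym (m+[n∸m]≡n a≤2t)
    a≡ : a ≡ b + (suc t + e)
    a≡ = trans (sym (m+[n∸m]≡n b≤a)) (cong (b +_) (sym (m+[n∸m]≡n (≰⇒> a-b≰t))))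
    t+t≡ : t + t ≡ t + ((f + suc b) + e)
    t+t≡ = trans 2t≡a+f (trans (cong (_+ f) a≡) (arrange b t e f))
      where
      arrange : ∀ b t e f → (b + (suc t + e)) + f ≡ t + ((f + suc b) + e)
      arrange = solve-∀
    j≤t : f + suc b ≤ t
    j≤t = subst (f + suc b ≤_) (sym (+-cancelˡ-≡ t t _ t+t≡)) (m≤m+n (f + suc b) e)
    wraps : fold b back (f + suc b) ≡ a
    wraps = begin
      fold b back (f + suc b)           ≡⟨ fold-+ b back f ⟩
      fold (back (fold b back b)) back f
        ≡⟨ cong (λ c → fold (back c) back f) (trans (fold-back b b ≤-refl) (n∸n≡0 b)) ⟩
      fold (t + t) back f               ≡⟨ fold-back f (t + t) (subst (f ≤_) (sym 2t≡a+f) (m≤n+m f a)) ⟩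
      t + t ∸ f                         ≡⟨ cong (_∸ f) 2t≡a+f ⟩
      a + f ∸ f                         ≡⟨ m+n∸n≡m a f ⟩
      a                                 ∎
      where open ≡-Reasoning

  within-t : ∀ {a b} → Colour a → Colour b → WithinT a b ⊎ WithinT b a
  within-t {a} {b} a-col b-col with ≤-total b a
  ... | inj₁ b≤a = within-t-ordered b≤a a-col
  ... | inj₂ a≤b with within-t-ordered a≤b b-col
  ...   | inj₁ w = inj₂ w
  ...   | inj₂ w = inj₁ w

  record Walk (L a b : ℕ) : Set where
    field
      at     : ℕ → ℕ
      start  : at 0 ≡ a
      end    : at L ≡ b
      valid  : ∀ i → Colour (at i)
      step   : ∀ i → i < L → at i ~ at (suc i)

  hops : ∀ k {a} → Colour a → Walk k a (fold a hop k)
  hops k {a} a-col = record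
    { at = fold a hop ; start = refl ; end = refl
    ; valid = λ i → fold-hop-colour i a-col ; step = λ i _ → hop-~ (fold a hop i) }

  reverse : ∀ {L a b} → Walk L a b → Walk L b a
  reverse {L} W = record
    { at = at ∘ (L ∸_) ; start = end ; end = trans (cong at (n∸n≡0 L)) start
    ; valid = valid ∘ (L ∸_) ; step = step′ }
    where
    open Walk W
    step′ : ∀ i → i < L → at (L ∸ i) ~ at (L ∸ suc i)
    step′ i i<L = subst (λ k → at k ~ at (L ∸ suc i)) (sym (+-∸-assoc 1 i<L))
      (~-sym (step (L ∸ suc i) (∸-monoʳ-< {o = 0} (s≤s z≤n) i<L)))

  _++_ : ∀ {L₁ L₂ a b c} → Walk L₁ a b → Walk L₂ b c → Walk (L₁ + L₂) a c
  _++_ {L₁} {L₂} W₁ W₂ = record { at = at ; start = trans (at-first 0 z≤n) (Walk.start W₁)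
    ; end = trans (at-second (L₁ + L₂) (m≤m+n L₁ L₂))
                  (trans (cong (Walk.at W₂) (m+n∸m≡n L₁ L₂)) (Walk.end W₂))
    ; valid = valid ; step = step }
    where
    at : ℕ → ℕ
    at i with i ≤? L₁
    ... | yes _ = Walk.at W₁ i
    ... | no  _ = Walk.at W₂ (i ∸ L₁)
    at-first : ∀ i → i ≤ L₁ → at i ≡ Walk.at W₁ i
    at-first i i≤L₁ with i ≤? L₁
    ... | yes _ = refl
    ... | no i≰L₁ = ⊥-elim (i≰L₁ i≤L₁)
    at-second : ∀ i → L₁ ≤ i → at i ≡ Walk.at W₂ (i ∸ L₁)
    at-second i L₁≤i with i ≤? L₁
    ... | no _ = refl
    ... | yes i≤L₁ with ≤-antisym i≤L₁ L₁≤i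
    ...   | refl = trans (Walk.end W₁) (trans (sym (Walk.start W₂)) (cong (Walk.at W₂) (sym (n∸n≡0 i))))
    valid : ∀ i → Colour (at i)
    valid i with i ≤? L₁
    ... | yes _ = Walk.valid W₁ i
    ... | no  _ = Walk.valid W₂ (i ∸ L₁)
    step : ∀ i → i < L₁ + L₂ → at i ~ at (suc i)
    step i i<L with <-≤-connex i L₁
    ... | inj₁ i<L₁ =
      subst₂ _~_ (sym (at-first i (<⇒≤ i<L₁))) (sym (at-first (suc i) i<L₁)) (Walk.step W₁ i i<L₁)
    ... | inj₂ L₁≤i = subst₂ _~_ (sym (at-second i L₁≤i))
          (sym (trans (at-second (suc i) (m≤n⇒m≤1+n L₁≤i)) (cong (Walk.at W₂) (+-∸-assoc 1 L₁≤i))))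
          (Walk.step W₂ (i ∸ L₁)
            (+-cancelˡ-< L₁ (i ∸ L₁) L₂ (subst (_< L₁ + L₂) (sym (m+[n∸m]≡n L₁≤i)) i<L)))

  -- hop^(t+j) a = hop^(t-j) (hop^(2j) a) = hop^(t-j) (back^j a), so hopping t + j times from a and
  -- then t - j times backwards from back^j a is a walk of length 2t.
  walk-within-t : ∀ {a} j → Colour a → j ≤ t → Walk (t + t) a (fold a back j)
  walk-within-t {a} j a-col j≤t = subst (λ L → Walk L a b) length (there ++ reverse (hops (t ∸ j) b-col))
    where
    b = fold a back j
    b-col : Colour b
    b-col = subst Colour (fold-hop-even j a-col) (fold-hop-colour (j + j) a-col)
    meet : fold a hop (t + j) ≡ fold b hop (t ∸ j)
    meet = begin
      fold a hop (t + j)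
        ≡⟨ cong (fold a hop) (trans (cong (_+ j) (sym (m∸n+n≡m j≤t))) (+-assoc (t ∸ j) j j)) ⟩
      fold a hop (t ∸ j + (j + j))         ≡⟨ fold-+ a hop (t ∸ j) ⟩
      fold (fold a hop (j + j)) hop (t ∸ j) ≡⟨ cong (λ c → fold c hop (t ∸ j)) (fold-hop-even j a-col) ⟩
      fold b hop (t ∸ j)                   ∎
      where open ≡-Reasoning
    there : Walk (t + j) a (fold b hop (t ∸ j))
    there = subst (Walk (t + j) a) meet (hops (t + j) a-col)
    length : t + j + (t ∸ j) ≡ t + t
    length = trans (+-assoc t j (t ∸ j)) (cong (t +_) (m+[n∸m]≡n j≤t))

  walk-2t : ∀ {a b} → Colour a → Colour b → Walk (t + t) a b
  walk-2t a-col b-col with within-t a-col b-col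
  ... | inj₁ (j , j≤t , a→b) = subst (Walk (t + t) _) a→b (walk-within-t j a-col j≤t)
  ... | inj₂ (j , j≤t , b→a) = reverse (subst (Walk (t + t) _) b→a (walk-within-t j b-col j≤t))

  bounce : ℕ → ℕ → ℕ
  bounce a zero          = a
  bounce a (suc zero)    = hop a
  bounce a (suc (suc i)) = bounce a i

  closed-walk : ∀ q {a} → Colour a → Walk (q + q) a a
  closed-walk q {a} a-col = record
    { at = bounce a ; start = refl ; end = bounce-even q ; valid = valid ; step = λ i _ → step i }
    where
    bounce-even : ∀ q → bounce a (q + q) ≡ a
    bounce-even zero    = refl
    bounce-even (suc q) rewrite +-suc q q = bounce-even q
    valid : ∀ i → Colour (bounce a i)
    valid zero          = a-col
    valid (suc zero)    = hop-colour a-col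
    valid (suc (suc i)) = valid i
    step : ∀ i → bounce a i ~ bounce a (suc i)
    step zero          = hop-~ a
    step (suc zero)    = ~-sym (hop-~ a)
    step (suc (suc i)) = step i

-- Colourings and reducible configurations

module Colourings (t : ℕ) where
  open CircularClique t public

  record Colouring (H : Graph) : Set where
    field
      colour   : Fin (n H) → ℕ
      in-range : ∀ v → Colour (colour v)
      proper   : ∀ u v → Adj H u v → colour u ~ colour v

  record PartialColouring (H : Graph) (keep : Fin (n H) → Bool) : Set where
    field
      colour   : Fin (n H) → ℕ
      in-range : ∀ v → Colour (colour v)
      proper   : ∀ u v → keep u ≡ true → keep v ≡ true → Adj H u v → colour u ~ colour v

  no-vertices : (H : Graph) → n H ≡ 0 → Colouring H
  no-vertices H n≡0 = record { colour = λ _ → 0 ; in-range = λ _ → z≤n ; proper = λ u → ⊥-elim (empty n≡0 u) }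
    where
    empty : ∀ {k} → k ≡ 0 → Fin k → _
    empty refl ()

  restrict : (H : Graph) (keep : Fin (n H) → Bool) → Colouring (induced H keep) → PartialColouring H keep
  restrict H keep φ = record { colour = colour ; in-range = in-range ; proper = proper }
    where
    open Enumeration (enumerate keep)
    colour : Fin (n H) → ℕ
    colour v with Fin.any? (λ i → index i Fin.≟ v)
    ... | yes (i , _) = Colouring.colour φ i
    ... | no  _       = 0
    in-range : ∀ v → Colour (colour v)
    in-range v with Fin.any? (λ i → index i Fin.≟ v)
    ... | yes (i , _) = Colouring.in-range φ i
    ... | no  _       = z≤n
    colour-index : ∀ i → colour (index i) ≡ Colouring.colour φ i
    colour-index i with Fin.any? (λ j → index j Fin.≟ index i)
    ... | yes (j , eq) = cong (Colouring.colour φ) (index-inj eq)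
    ... | no  none     = ⊥-elim (none (i , refl))
    proper : ∀ u v → keep u ≡ true → keep v ≡ true → Adj H u v → colour u ~ colour v
    proper u v keep-u keep-v uv with index-onto u keep-u | index-onto v keep-v
    ... | i , refl | j , refl rewrite colour-index i | colour-index j = Colouring.proper φ i j uv

  patch : ∀ {k} → (Fin k → Bool) → (Fin k → ℕ) → (Fin k → ℕ) → Fin k → ℕ
  patch keep φ ψ v = if keep v then φ v else ψ v

  patch-kept : ∀ {k} (keep : Fin k → Bool) (φ ψ : Fin k → ℕ) {v} → keep v ≡ true → patch keep φ ψ v ≡ φ v
  patch-kept keep φ ψ {v} kept = cong (λ b → if b then φ v else ψ v) kept

  patch-deleted : ∀ {k} (keep : Fin k → Bool) (φ ψ : Fin k → ℕ) {v} → keep v ≡ false → patch keep φ ψ v ≡ ψ v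
  patch-deleted keep φ ψ {v} deleted = cong (λ b → if b then φ v else ψ v) deleted

  extend : {H : Graph} {keep : Fin (n H) → Bool} (φ : PartialColouring H keep) {ψ : Fin (n H) → ℕ} →
           (∀ v → Colour (ψ v)) →
           (∀ u v → keep u ≡ false → Adj H u v →
              patch keep (PartialColouring.colour φ) ψ u ~ patch keep (PartialColouring.colour φ) ψ v) →
           Colouring H
  extend {H} {keep} φ {ψ} ψ-in-range at-deleted = record { colour = χ ; in-range = in-range ; proper = proper }
    where
    open PartialColouring φ using (colour)
    χ = patch keep colour ψ
    in-range : ∀ v → Colour (χ v)
    in-range v with true-or-false (keep v)
    ... | inj₁ kept    = subst Colour (sym (patch-kept keep colour ψ kept)) (PartialColouring.in-range φ v)
    ... | inj₂ deleted = subst Colour (sym (patch-deleted keep colour ψ deleted)) (ψ-in-range v)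
    proper : ∀ u v → Adj H u v → χ u ~ χ v
    proper u v uv with true-or-false (keep u) | true-or-false (keep v)
    ... | inj₂ u-deleted | _            = at-deleted u v u-deleted uv
    ... | inj₁ _        | inj₂ v-deleted = ~-sym (at-deleted v u v-deleted (adj-symmetric H uv))
    ... | inj₁ u-kept   | inj₁ v-kept    =
      subst₂ _~_ (sym (patch-kept keep colour ψ u-kept)) (sym (patch-kept keep colour ψ v-kept))
        (PartialColouring.proper φ u v u-kept v-kept uv)

  DeletionsColourable : Graph → Set
  DeletionsColourable H = ∀ (keep : Fin (n H) → Bool) {v} → keep v ≡ false → Colouring (induced H keep)

  leaf-reducible : (H : Graph) → DeletionsColourable H → (v : Fin (n H)) → degree H v ≤ 1 → Colouring H
  leaf-reducible H smaller v degree≤1 = extend φ₀ (λ _ → c-range) at-v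
    where
    keep : Fin (n H) → Bool
    keep u = not (u ≡ᵇ v)
    φ₀ = restrict H keep (smaller keep {v} (cong not (≡ᵇ-refl v)))
    open PartialColouring φ₀ using (colour; in-range)
    c : ℕ
    c with Fin.any? (λ u → adj H v u Bool.≟ true)
    ... | yes (u , _) = hop (colour u)
    ... | no  _       = 0
    c-range : Colour c
    c-range with Fin.any? (λ u → adj H v u Bool.≟ true)
    ... | yes (u , _) = hop-colour (in-range u)
    ... | no  _       = z≤n
    c~neighbour : ∀ {y} → Adj H v y → c ~ colour y
    c~neighbour {y} vy with Fin.any? (λ u → adj H v u Bool.≟ true)
    ... | no  none    = ⊥-elim (none (y , vy))
    ... | yes (u , vu) rewrite count≤1⇒unique (adj H v) degree≤1 vu vy = ~-sym (hop-~ (colour u))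
    at-v : ∀ u y → keep u ≡ false → Adj H u y → patch keep colour (λ _ → c) u ~ patch keep colour (λ _ → c) y
    at-v u y u-deleted uy with ≡ᵇ-true⇒≡ {x = u} {v} (not-injective {y = true} u-deleted)
    ... | refl = subst₂ _~_ (sym (patch-deleted keep colour (λ _ → c) u-deleted))
                   (sym (patch-kept keep colour (λ _ → c) y-kept)) (c~neighbour uy)
      where
      y-kept : keep y ≡ true
      y-kept = cong not (dec-false (y Fin.≟ v) (adj-irreflexive H uy ∘ sym))

  -- Consecutive vertices need not be adjacent and the two ends may coincide: only the neighbourhoods
  -- of the interior vertices matter.
  record Thread (H : Graph) (L : ℕ) : Set where
    field
      vertex              : ℕ → Fin (n H)
      long                : 2 ≤ L
      interior-neighbours : ∀ i → suc i < L → ∀ x → Adj H (vertex (suc i)) x →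
                            x ≡ vertex i ⊎ x ≡ vertex (suc (suc i))
      interior-injective  : ∀ i j → 1 ≤ i → i < L → 1 ≤ j → j < L → vertex i ≡ vertex j → i ≡ j
      interior≢start      : ∀ i → 1 ≤ i → i < L → vertex i ≢ vertex 0
      interior≢end        : ∀ i → 1 ≤ i → i < L → vertex i ≢ vertex L

  WalksBetweenEnds : {H : Graph} {L : ℕ} → Thread H L → Set
  WalksBetweenEnds {L = L} T =
    ∀ {a b} → Colour a → Colour b → (Thread.vertex T 0 ≡ Thread.vertex T L → a ≡ b) → Walk L a b

  module ThreadRecolouring (H : Graph) (smaller : DeletionsColourable H) {L : ℕ} (T : Thread H L)
                           (walks : WalksBetweenEnds T) where
    open Thread T

    Interior : Fin (n H) → Set
    Interior v = ∃ λ (i : Fin L) → 1 ≤ toℕ i × vertex (toℕ i) ≡ v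

    interior? : ∀ v → Dec (Interior v)
    interior? v = Fin.any? (λ i → (1 ≤? toℕ i) ×-dec (vertex (toℕ i) Fin.≟ v))

    interior : ∀ k → 1 ≤ k → k < L → Interior (vertex k)
    interior k 1≤k k<L =
      fromℕ< k<L , subst (1 ≤_) (sym (Fin.toℕ-fromℕ< k<L)) 1≤k , cong vertex (Fin.toℕ-fromℕ< k<L)

    keep : Fin (n H) → Bool
    keep v = not (does (interior? v))

    deleted : ∀ k → 1 ≤ k → k < L → keep (vertex k) ≡ false
    deleted k 1≤k k<L = cong not (dec-true (interior? (vertex k)) (interior k 1≤k k<L))

    kept : ∀ {v} → ¬ Interior v → keep v ≡ true
    kept {v} not-interior = cong not (dec-false (interior? v) not-interior)

    deleted⇒interior : ∀ {v} → keep v ≡ false → Interior v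
    deleted⇒interior {v} v-deleted with interior? v
    ... | yes v-interior = v-interior
    deleted⇒interior () | no _

    φ₀ : PartialColouring H keep
    φ₀ = restrict H keep (smaller keep (deleted 1 ≤-refl long))

    open PartialColouring φ₀ using (colour; in-range)
    open Walk (walks (in-range (vertex 0)) (in-range (vertex L)) (cong colour))

    ψ : Fin (n H) → ℕ
    ψ v with interior? v
    ... | yes (i , _) = at (toℕ i)
    ... | no  _       = 0

    ψ-range : ∀ v → Colour (ψ v)
    ψ-range v with interior? v
    ... | yes (i , _) = valid (toℕ i)
    ... | no  _       = z≤n

    ψ-interior : ∀ k → 1 ≤ k → k < L → ψ (vertex k) ≡ at k
    ψ-interior k 1≤k k<L with interior? (vertex k)
    ... | yes (i , 1≤i , i↦k) = cong at (interior-injective (toℕ i) k 1≤i (Fin.toℕ<n i) 1≤k k<L i↦k)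
    ... | no  not-interior    = ⊥-elim (not-interior (interior k 1≤k k<L))

    χ : Fin (n H) → ℕ
    χ = patch keep colour ψ

    χ-on-thread : ∀ k → k ≤ L → χ (vertex k) ≡ at k
    χ-on-thread zero _ = trans (patch-kept keep colour ψ start-kept) (sym start)
      where
      start-kept = kept λ (i , 1≤i , i↦0) → interior≢start (toℕ i) 1≤i (Fin.toℕ<n i) i↦0
    χ-on-thread (suc k) k<L with suc k ≟ L
    ... | yes refl = trans (patch-kept keep colour ψ end-kept) (sym end)
      where
      end-kept = kept λ (i , 1≤i , i↦L) → interior≢end (toℕ i) 1≤i (Fin.toℕ<n i) i↦L
    ... | no  k≢L  =
      trans (patch-deleted keep colour ψ (deleted (suc k) (s≤s z≤n) k<L′)) (ψ-interior (suc k) (s≤s z≤n) k<L′)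
      where
      k<L′ : suc k < L
      k<L′ = ≤∧≢⇒< k<L k≢L

    at-deleted : ∀ u y → keep u ≡ false → Adj H u y → χ u ~ χ y
    at-deleted u y u-deleted uy with deleted⇒interior u-deleted
    ... | i , 1≤i , refl with toℕ i | Fin.toℕ<n i | 1≤i
    ...   | suc k | k<L | _ with interior-neighbours k k<L y uy
    ...     | inj₁ refl = subst₂ _~_ (sym (χ-on-thread (suc k) (<⇒≤ k<L))) (sym (χ-on-thread k (<⇒≤ k<L′)))
                            (~-sym (step k k<L′))
      where
      k<L′ : k < L
      k<L′ = ≤-trans (n≤1+n (suc k)) k<L
    ...     | inj₂ refl = subst₂ _~_ (sym (χ-on-thread (suc k) (<⇒≤ k<L))) (sym (χ-on-thread (suc (suc k)) k<L))
                            (step (suc k) k<L)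

  thread-reducible : (H : Graph) → DeletionsColourable H → {L : ℕ} (T : Thread H L) → WalksBetweenEnds T →
                     Colouring H
  thread-reducible H smaller T walks = extend φ₀ ψ-range at-deleted
    where open ThreadRecolouring H smaller T walks

-- Threads

least : (P : ℕ → Set) → (∀ j → Dec (P j)) → ∀ m →
        (∀ j → j ≤ m → ¬ P j) ⊎ ∃ λ j → j ≤ m × P j × (∀ i → i < j → ¬ P i)
least P P? zero with P? 0
... | yes P0  = inj₂ (0 , z≤n , P0 , λ _ ())
... | no  ¬P0 = inj₁ λ { zero _ → ¬P0 }
least P P? (suc m) with least P P? m
... | inj₂ (j , j≤m , Pj , below) = inj₂ (j , m≤n⇒m≤1+n j≤m , Pj , below)
... | inj₁ none with P? (suc m)
...   | yes Pm  = inj₂ (suc m , ≤-refl , Pm , λ i i<1+m → none i (≤-pred i<1+m))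
...   | no  ¬Pm = inj₁ λ j j≤1+m → case (m≤n⇒m<n∨m≡n j≤1+m) of λ
          { (inj₁ j<1+m) → none j (≤-pred j<1+m) ; (inj₂ refl) → ¬Pm }

even-or-odd : ∀ j → (∃ λ q → j ≡ q + q) ⊎ Odd j
even-or-odd zero = inj₁ (0 , refl)
even-or-odd (suc zero) = inj₂ (0 , refl)
even-or-odd (suc (suc j)) with even-or-odd j
... | inj₁ (q , j≡) = inj₁ (suc q , trans (cong (λ k → 2 + k) j≡) (sym (+-suc (suc q) q)))
... | inj₂ (q , j≡) = inj₂ (suc q , trans (cong (λ k → 2 + k) j≡) (cong suc (sym (*-suc 2 q))))

module _ (H : Graph) where

  isDegree2 : Fin (n H) → Bool
  isDegree2 y = does (degree H y ≟ 2)

  isDegree2⇒degree≡2 : ∀ {y} → isDegree2 y ≡ true → degree H y ≡ 2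
  isDegree2⇒degree≡2 {y} = witness (degree H y ≟ 2)
    where
    witness : ∀ {A : Set} (d : Dec A) → does d ≡ true → A
    witness (yes a) _ = a

  -- The neighbour of y other than x, or x itself if there is none.
  next : Fin (n H) → Fin (n H) → Fin (n H)
  next y x with Fin.any? (λ z → (adj H y z Bool.≟ true) ×-dec ¬? (z Fin.≟ x))
  ... | yes (z , _) = z
  ... | no  _       = x

  next-spec : ∀ {y x} → 2 ≤ degree H y → Adj H y x → Adj H y (next y x) × next y x ≢ x
  next-spec {y} {x} 2≤deg yx with Fin.any? (λ z → (adj H y z Bool.≟ true) ×-dec ¬? (z Fin.≟ x))
  ... | yes (z , yz , z≢x) = yz , z≢x
  ... | no  none           = ⊥-elim (none (count≥2⇒another (adj H y) 2≤deg yx))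

  next-unique : ∀ {y x z} → degree H y ≡ 2 → Adj H y x → Adj H y z → z ≢ x → next y x ≡ z
  next-unique {y} {x} {z} deg≡2 yx yz z≢x with next-spec (≤-reflexive (sym deg≡2)) yx
  ... | y-next , next≢x with count≤2⇒pair (adj H y) (≤-reflexive deg≡2) (z≢x ∘ sym) yx yz y-next
  ...   | inj₁ next≡x = ⊥-elim (next≢x next≡x)
  ...   | inj₂ next≡z = next≡z

  -- The number of consecutive degree-2 vertices y, next y x, ... met when entering y from x, capped at f.
  threadLength : ℕ → Fin (n H) → Fin (n H) → ℕ
  threadLength zero    x y = 0
  threadLength (suc f) x y = if isDegree2 y then suc (threadLength f y (next y x)) else 0

  threadLength-stop : ∀ f {x y} → isDegree2 y ≡ false → threadLength f x y ≡ 0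
  threadLength-stop zero    _     = refl
  threadLength-stop (suc f) {x} {y} y-not2 = cong (λ b → if b then suc (threadLength f y (next y x)) else 0) y-not2

  threadLength-step : ∀ f {x y} → isDegree2 y ≡ true → threadLength (suc f) x y ≡ suc (threadLength f y (next y x))
  threadLength-step f {x} {y} y-2 = cong (λ b → if b then suc (threadLength f y (next y x)) else 0) y-2

  threadLength-uncapped : ∀ f x y → threadLength (suc f) x y ≢ suc f → threadLength f x y ≡ threadLength (suc f) x y
  threadLength-uncapped zero x y ne with isDegree2 y
  ... | true  = ⊥-elim (ne refl)
  ... | false = refl
  threadLength-uncapped (suc f) x y ne with isDegree2 y
  ... | true  = cong suc (threadLength-uncapped f y (next y x) (ne ∘ cong suc))
  ... | false = refl

  threadLength-pos : ∀ f {x y} → 1 ≤ threadLength f x y → isDegree2 y ≡ true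
  threadLength-pos (suc f) {x} {y} pos with isDegree2 y
  ... | true = refl

module LongThread (t′ : ℕ) (H : Graph) (min-degree : ∀ v → 2 ≤ degree H v)
                  {x₀ y₀ : Fin (n H)} (x₀y₀ : Adj H x₀ y₀)
                  (long : suc (t′ + t′) ≤ threadLength H (suc (t′ + t′)) x₀ y₀) where
  open Colourings (suc t′)

  N : ℕ
  N = suc (t′ + t′)

  L : ℕ
  L = suc N

  w : ℕ → Fin (n H)
  w zero          = x₀
  w (suc zero)    = y₀
  w (suc (suc i)) = next H (w (suc i)) (w i)

  degree2-along : ∀ f i k → suc k ≤ threadLength H f (w i) (w (suc i)) → isDegree2 H (w (suc (k + i))) ≡ true
  degree2-along f       i zero    pos = threadLength-pos H f pos
  degree2-along zero    i (suc k) ()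
  degree2-along (suc f) i (suc k) pos = subst (λ j → isDegree2 H (w (suc j)) ≡ true) (+-suc k i)
    (degree2-along f (suc i) k (≤-pred (subst (suc (suc k) ≤_) (threadLength-step H f entered) pos)))
    where
    entered : isDegree2 H (w (suc i)) ≡ true
    entered = threadLength-pos H (suc f) (≤-trans (s≤s z≤n) pos)

  walk-degree2 : ∀ k → k < N → degree H (w (suc k)) ≡ 2
  walk-degree2 k k<N = isDegree2⇒degree≡2 H
    (subst (λ j → isDegree2 H (w (suc j)) ≡ true) (+-identityʳ k) (degree2-along N 0 k (≤-trans k<N long)))

  walk-adjacent : ∀ i → i ≤ N → Adj H (w i) (w (suc i))
  walk-adjacent zero    _   = x₀y₀
  walk-adjacent (suc k) k<N = proj₁ (next-spec H (min-degree _) (adj-symmetric H (walk-adjacent k (<⇒≤ k<N))))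

  walk-no-backtrack : ∀ k → k < N → w (suc (suc k)) ≢ w k
  walk-no-backtrack k k<N = proj₂ (next-spec H (min-degree _) (adj-symmetric H (walk-adjacent k (<⇒≤ k<N))))

  walk-neighbours : ∀ k → k < N → ∀ x → Adj H (w (suc k)) x → x ≡ w k ⊎ x ≡ w (suc (suc k))
  walk-neighbours k k<N x =
    count≤2⇒pair (adj H (w (suc k))) (≤-reflexive (walk-degree2 k k<N)) (walk-no-backtrack k k<N ∘ sym)
      (adj-symmetric H (walk-adjacent k (<⇒≤ k<N))) (walk-adjacent (suc k) k<N)

  Repeat : ℕ → Set
  Repeat j = ∃ λ (i : Fin j) → w (toℕ i) ≡ w j

  repeat? : ∀ j → Dec (Repeat j)
  repeat? j = Fin.any? (λ i → w (toℕ i) Fin.≟ w j)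

  repeat : ∀ {i j} → i < j → w i ≡ w j → Repeat j
  repeat i<j wi≡wj = fromℕ< i<j , trans (cong w (Fin.toℕ-fromℕ< i<j)) wi≡wj

  NoRepeatBelow : ℕ → Set
  NoRepeatBelow j = ∀ i → i < j → ¬ Repeat i

  distinct-below : ∀ {j} → NoRepeatBelow j → ∀ a b → a < j → b < j → w a ≡ w b → a ≡ b
  distinct-below none a b a<j b<j wa≡wb with <-cmp a b
  ... | tri< a<b _ _ = ⊥-elim (none b b<j (repeat a<b wa≡wb))
  ... | tri≈ _ a≡b _ = a≡b
  ... | tri> _ _ b<a = ⊥-elim (none a a<j (repeat b<a (sym wa≡wb)))

  -- A first repeated vertex must be the start vertex: any other earlier vertex has degree 2, and both
  -- of its neighbours occur before the repetition.
  first-repeat-closes : ∀ {j} → j ≤ L → Repeat j → NoRepeatBelow j → w 0 ≡ w j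
  first-repeat-closes {suc j₁} j≤L (i , wi≡wj) none =
    subst (λ k → w k ≡ w (suc j₁)) (returns-to-start (toℕ i) i<j₁ wi≡wj) wi≡wj
    where
    j₁≤N : j₁ ≤ N
    j₁≤N = ≤-pred j≤L
    i<j₁ : toℕ i < j₁
    i<j₁ = ≤∧≢⇒< (≤-pred (Fin.toℕ<n i))
      λ i≡j₁ → adj-irreflexive H (walk-adjacent j₁ j₁≤N) (trans (cong w (sym i≡j₁)) wi≡wj)
    returns-to-start : ∀ k → k < j₁ → w k ≡ w (suc j₁) → k ≡ 0
    returns-to-start zero    _     _      = refl
    returns-to-start (suc k) k+1<j₁ wk+1≡wj
      with walk-neighbours k (≤-trans (n≤1+n (suc k)) (≤-trans k+1<j₁ j₁≤N)) (w j₁)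
             (subst (λ v → Adj H v (w j₁)) (sym wk+1≡wj) (adj-symmetric H (walk-adjacent j₁ j₁≤N)))
    ... | inj₁ wj₁≡wk = ⊥-elim (none j₁ (n<1+n j₁) (repeat (≤-trans (n≤1+n (suc k)) k+1<j₁) (sym wj₁≡wk)))
    ... | inj₂ wj₁≡wk+2 with m≤n⇒m<n∨m≡n k+1<j₁
    ...   | inj₁ k+2<j₁ = ⊥-elim (none j₁ (n<1+n j₁) (repeat k+2<j₁ (sym wj₁≡wk+2)))
    ...   | inj₂ refl   = ⊥-elim (walk-no-backtrack (suc k) j₁≤N (sym wk+1≡wj))

  closing-repeat-long : ∀ {j} → Repeat j → w 0 ≡ w j → 3 ≤ j
  closing-repeat-long {suc zero}          _ w0≡w1 = ⊥-elim (adj-irreflexive H x₀y₀ w0≡w1)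
  closing-repeat-long {suc (suc zero)}    _ w0≡w2 = ⊥-elim (walk-no-backtrack 0 (s≤s z≤n) (sym w0≡w2))
  closing-repeat-long {suc (suc (suc j))} _ _     = s≤s (s≤s (s≤s z≤n))

  walk-thread : ∀ {l} → 2 ≤ l → l ≤ L → (∀ a b → a < l → b < l → w a ≡ w b → a ≡ b) →
                (∀ a → 1 ≤ a → a < l → w a ≢ w l) → Thread H l
  walk-thread {l} 2≤l l≤L distinct ≢end = record
    { vertex = w ; long = 2≤l
    ; interior-neighbours = λ i i+1<l → walk-neighbours i (≤-pred (≤-trans i+1<l l≤L))
    ; interior-injective = λ a b _ a<l _ b<l → distinct a b a<l b<l
    ; interior≢start = λ { (suc a) _ a<l wa≡w0 →
        case distinct (suc a) 0 a<l (≤-trans (s≤s z≤n) 2≤l) wa≡w0 of λ () }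
    ; interior≢end = ≢end }

  open-thread : (∀ j → j ≤ L → ¬ Repeat j) → Thread H L
  open-thread none = walk-thread (s≤s (s≤s z≤n)) ≤-refl
    (λ a b a<L b<L → distinct-below none′ a b (m<n⇒m<1+n a<L) (m<n⇒m<1+n b<L))
    λ a _ a<L wa≡wL → <-irrefl (distinct-below none′ a L (≤-trans a<L (n≤1+n L)) ≤-refl wa≡wL) a<L
    where
    none′ : NoRepeatBelow (suc L)
    none′ i i≤L = none i (≤-pred i≤L)

  closed-thread : ∀ {j} → 3 ≤ j → j ≤ L → NoRepeatBelow j → w 0 ≡ w j → Thread H j
  closed-thread {j} 3≤j j≤L none w0≡wj = walk-thread (≤-trans (n≤1+n 2) 3≤j) j≤L (distinct-below none)
    λ { (suc a) _ a<j wa≡wj →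
        case distinct-below none (suc a) 0 a<j (≤-trans (s≤s z≤n) 3≤j) (trans wa≡wj (sym w0≡wj)) of λ () }

  closed-cycle : ∀ {j} → 3 ≤ j → j ≤ L → NoRepeatBelow j → w 0 ≡ w j → Cycle H j
  closed-cycle {suc j₁} 3≤j j≤L none w0≡wj = record
    { m = j₁ ; len = refl ; long = 3≤j ; c = w ∘ toℕ
    ; inj = λ {a} {b} wa≡wb →
        Fin.toℕ-injective (distinct-below none (toℕ a) (toℕ b) (Fin.toℕ<n a) (Fin.toℕ<n b) wa≡wb)
    ; step = λ k → subst (λ i → Adj H (w i) (w (suc (toℕ k)))) (sym (Fin.toℕ-inject₁ k))
                     (walk-adjacent (toℕ k) (≤-trans (<⇒≤ (Fin.toℕ<n k)) (≤-pred j≤L)))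
    ; closing = subst₂ (λ i v → Adj H (w i) v) (sym (Fin.toℕ-fromℕ j₁)) (sym w0≡wj)
                  (walk-adjacent j₁ (≤-pred j≤L)) }

  L<2t+1 : L < 2 * suc t′ + 1
  L<2t+1 = ≤-reflexive (arith t′)
    where
    arith : ∀ t′ → suc (suc (suc (t′ + t′))) ≡ 2 * suc t′ + 1
    arith = solve-∀

  -- Without repetitions w₀, …, w_2t is a thread of length 2t; otherwise its first repetition closes a
  -- cycle of length at most 2t, which is even by the girth hypothesis.
  reducible : DeletionsColourable H → OddGirth≥ H (2 * suc t′ + 1) → Colouring H
  reducible smaller girth with least Repeat repeat? L
  ... | inj₁ none = thread-reducible H smaller (open-thread none)
        λ {a} {b} a-col b-col _ → subst (λ l → Walk l a b) (cong suc (+-suc t′ t′)) (walk-2t a-col b-col)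
  ... | inj₂ (j , j≤L , rep , none) with first-repeat-closes j≤L rep none
  ...   | w0≡wj with closing-repeat-long rep w0≡wj | even-or-odd j
  ...     | 3≤j | inj₁ (q , j≡q+q) = thread-reducible H smaller (closed-thread 3≤j j≤L none w0≡wj)
            λ {a} a-col _ a≡b → subst₂ (λ l b → Walk l a b) (sym j≡q+q) (a≡b w0≡wj) (closed-walk q a-col)
  ...     | 3≤j | inj₂ odd =
            ⊥-elim (<⇒≱ (≤-<-trans j≤L L<2t+1) (girth j odd (closed-cycle 3≤j j≤L none w0≡wj)))

-- Discharging

module Discharging (t′ : ℕ) (H : Graph) (min-degree : ∀ v → 2 ≤ degree H v)
                   (short : ∀ {x y} → Adj H x y → threadLength H (suc (t′ + t′)) x y < suc (t′ + t′)) where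

  N : ℕ
  N = suc (t′ + t′)

  b : ℕ
  b = suc (3 * t′)

  a : ℕ
  a = 2 * b + 1

  incoming : Fin (n H) → ℕ
  incoming v = sumWhere (λ x → adj H x v) (λ x → threadLength H N x v)

  outgoing : Fin (n H) → ℕ
  outgoing v = sumWhere (adj H v) (threadLength H N v)

  threadLength-through : ∀ {v x y} → degree H v ≡ 2 → Adj H v x → Adj H v y → y ≢ x →
                         threadLength H N x v ≡ suc (threadLength H N v y)
  threadLength-through {v} {x} {y} deg≡2 vx vy y≢x = begin
    threadLength H N x v
      ≡⟨ threadLength-step H (t′ + t′) (dec-true (degree H v ≟ 2) deg≡2) ⟩
    suc (threadLength H (t′ + t′) v (next H v x))
      ≡⟨ cong (suc ∘ threadLength H (t′ + t′) v) (next-unique H deg≡2 vx vy y≢x) ⟩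
    suc (threadLength H (t′ + t′) v y)
      ≡⟨ cong suc (threadLength-uncapped H (t′ + t′) v y (<⇒≢ (short vy))) ⟩
    suc (threadLength H N v y)
      ∎
    where open ≡-Reasoning

  degree2-balance : ∀ {v} → degree H v ≡ 2 → incoming v ≡ 2 + outgoing v
  degree2-balance {v} deg≡2 with degree2-neighbours H deg≡2
  ... | u₁ , u₂ , u₁≢u₂ , vu₁ , vu₂ , only = begin
    incoming v                                      ≡⟨ sumWhere-cong _ (λ x → adj-sym H x v) ⟩
    sumWhere (adj H v) (λ x → threadLength H N x v) ≡⟨ sumWhere-two (adj H v) _ u₁≢u₂ vu₁ vu₂ only ⟩
    threadLength H N u₁ v + threadLength H N u₂ v
      ≡⟨ cong₂ _+_ (threadLength-through deg≡2 vu₁ vu₂ (u₁≢u₂ ∘ sym))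
                   (threadLength-through deg≡2 vu₂ vu₁ u₁≢u₂) ⟩
    suc (ℓ u₂) + suc (ℓ u₁)                         ≡⟨ arrange (ℓ u₂) (ℓ u₁) ⟩
    2 + (ℓ u₁ + ℓ u₂)
      ≡⟨ cong (2 +_) (sumWhere-two (adj H v) _ u₁≢u₂ vu₁ vu₂ only) ⟨
    2 + outgoing v                                  ∎
    where
    open ≡-Reasoning
    ℓ = threadLength H N v
    arrange : ∀ p q → suc p + suc q ≡ 2 + (q + p)
    arrange = solve-∀

  not-degree2-incoming : ∀ {v} → degree H v ≢ 2 → incoming v ≡ 0
  not-degree2-incoming {v} deg≢2 = sumWhere-zero {P = λ x → adj H x v} {λ x → threadLength H N x v}
    λ x _ → threadLength-stop H N (dec-false (degree H v ≟ 2) deg≢2)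

  outgoing-bound : ∀ v → outgoing v ≤ (t′ + t′) * degree H v
  outgoing-bound v = sumWhere-≤ (threadLength H N v) (t′ + t′) λ x vx → ≤-pred (short vx)

  discharge : ∀ v → 2 * a + outgoing v ≤ 2 * b * degree H v + incoming v
  discharge v with degree H v ≟ 2
  ... | yes deg≡2 = ≤-reflexive (begin
    2 * a + outgoing v              ≡⟨ arrange (outgoing v) t′ ⟩
    2 * b * 2 + (2 + outgoing v)    ≡⟨ cong₂ (λ d i → 2 * b * d + i) deg≡2 (degree2-balance deg≡2) ⟨
    2 * b * degree H v + incoming v ∎)
    where
    open ≡-Reasoning
    arrange : ∀ o t′ → 2 * (2 * suc (3 * t′) + 1) + o ≡ 2 * suc (3 * t′) * 2 + (2 + o)
    arrange = solve-∀
  ... | no deg≢2 = begin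
    2 * a + outgoing v                                 ≤⟨ +-monoʳ-≤ (2 * a) (outgoing-bound v) ⟩
    2 * a + (t′ + t′) * degree H v                     ≡⟨ cong (λ d → 2 * a + (t′ + t′) * d) deg≡3+r ⟩
    2 * a + (t′ + t′) * (3 + r)                        ≤⟨ m≤m+n _ ((4 * t′ + 2) * r) ⟩
    2 * a + (t′ + t′) * (3 + r) + (4 * t′ + 2) * r     ≡⟨ arrange t′ r ⟩
    2 * b * (3 + r) + 0
      ≡⟨ cong₂ (λ d i → 2 * b * d + i) deg≡3+r (not-degree2-incoming deg≢2) ⟨
    2 * b * degree H v + incoming v                    ∎
    where
    open ≤-Reasoning
    r = degree H v ∸ 3
    deg≡3+r : degree H v ≡ 3 + r
    deg≡3+r = sym (m+[n∸m]≡n (≤∧≢⇒< (min-degree v) (deg≢2 ∘ sym)))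
    arrange : ∀ t′ r → 2 * (2 * suc (3 * t′) + 1) + (t′ + t′) * (3 + r) + (4 * t′ + 2) * r
                       ≡ 2 * suc (3 * t′) * (3 + r) + 0
    arrange = solve-∀

  total : n H * (2 * a) ≤ 2 * b * (2 * ∣E∣ H)
  total = +-cancelʳ-≤ (sum outgoing) _ _ (begin
    n H * (2 * a) + sum outgoing                  ≡⟨ cong (_+ sum outgoing) (sum-const (n H) (2 * a)) ⟨
    sum {n H} (λ _ → 2 * a) + sum outgoing        ≡⟨ ∑-distrib-+ (λ _ → 2 * a) outgoing ⟨
    sum (λ v → 2 * a + outgoing v)                ≤⟨ sum-mono-≤ discharge ⟩
    sum (λ v → 2 * b * degree H v + incoming v)   ≡⟨ ∑-distrib-+ (λ v → 2 * b * degree H v) incoming ⟩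
    sum (λ v → 2 * b * degree H v) + sum incoming
      ≡⟨ cong₂ _+_ (*-distribˡ-sum (2 * b) (degree H)) (sym incoming≡outgoing) ⟨
    2 * b * sum (degree H) + sum outgoing         ≡⟨ cong (λ s → 2 * b * s + sum outgoing) (handshake H) ⟨
    2 * b * (2 * ∣E∣ H) + sum outgoing            ∎)
    where
    open ≤-Reasoning
    incoming≡outgoing : sum incoming ≡ sum outgoing
    incoming≡outgoing = ∑-comm λ v x → if adj H x v then threadLength H N x v else 0

module _ (t′ : ℕ) (G : Graph) (girth : OddGirth≥ G (2 * suc t′ + 1))
         (mad : MadLt G (2 * (3 * suc t′ ∸ 2) + 1) (3 * suc t′ ∸ 2)) where
  open Colourings (suc t′)

  private
    N : ℕ
    N = suc (t′ + t′)

  short-threads-violate-mad : (H : Graph) → H ⊆G G → 1 ≤ n H → (∀ v → 2 ≤ degree H v) →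
                              (∀ {x y} → Adj H x y → threadLength H N x y < N) → ⊥
  short-threads-violate-mad H H⊆G nonempty min-degree short = <-irrefl refl (begin-strict
    2 * (2 * E * b)   <⟨ *-monoʳ-< 2 sparse ⟩
    2 * (a * n H)     ≡⟨ arrange₁ a (n H) ⟩
    n H * (2 * a)     ≤⟨ total ⟩
    2 * b * (2 * E)   ≡⟨ arrange₂ b E ⟩
    2 * (2 * E * b)   ∎)
    where
    open Discharging t′ H min-degree short
    open ≤-Reasoning
    E = ∣E∣ H
    3t∸2≡b : 3 * suc t′ ∸ 2 ≡ b
    3t∸2≡b = cong (_∸ 2) (arrange t′)
      where
      arrange : ∀ t′ → 3 * suc t′ ≡ 3 + 3 * t′
      arrange = solve-∀
    sparse : 2 * E * b < a * n H
    sparse = subst (λ d → 2 * E * d < (2 * d + 1) * n H) 3t∸2≡b (mad H H⊆G nonempty)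
    arrange₁ : ∀ a n → 2 * (a * n) ≡ n * (2 * a)
    arrange₁ = solve-∀
    arrange₂ : ∀ b e → 2 * b * (2 * e) ≡ 2 * (2 * e * b)
    arrange₂ = solve-∀

  reduce-min-degree-2 : (H : Graph) → H ⊆G G → DeletionsColourable H → 1 ≤ n H → (∀ v → 2 ≤ degree H v) →
                        Colouring H
  reduce-min-degree-2 H H⊆G smaller nonempty min-degree
    with Fin.any? (λ x → Fin.any? (λ y → (adj H x y Bool.≟ true) ×-dec (N ≤? threadLength H N x y)))
  ... | yes (x , y , xy , long) = LongThread.reducible t′ H min-degree xy long smaller (oddGirth-⊆ H⊆G girth)
  ... | no no-long = ⊥-elim (short-threads-violate-mad H H⊆G nonempty min-degree
                               λ {x} {y} xy → ≰⇒> λ long → no-long (x , y , xy , long))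

  reduce : (H : Graph) → H ⊆G G → DeletionsColourable H → Colouring H
  reduce H H⊆G smaller with n H ≟ 0 | Fin.any? (λ v → degree H v ≤? 1)
  ... | yes empty   | _              = no-vertices H empty
  ... | no _        | yes (v , leaf) = leaf-reducible H smaller v leaf
  ... | no nonempty | no no-leaf     =
    reduce-min-degree-2 H H⊆G smaller (n≢0⇒n>0 nonempty) λ v → ≰⇒> λ leaf → no-leaf (v , leaf)

  colourable : ∀ m (H : Graph) → n H ≤ m → H ⊆G G → Colouring H
  colourable zero    H n≤0   _   = no-vertices H (n≤0⇒n≡0 n≤0)
  colourable (suc m) H n≤1+m H⊆G = reduce H H⊆G λ keep dropped →
    colourable m (induced H keep) (≤-pred (≤-trans (induced-smaller H dropped) n≤1+m))
      (⊆-trans {induced H keep} {H} {G} (induced-⊆ H keep) H⊆G)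

circular-colouring-bound : ∀ {t} → 1 ≤ t → (G : Graph) → Colourings.Colouring t G → ChiCLe G (2 * t + 1) t
circular-colouring-bound {t} 1≤t G φ x y _ bound =
  2 * t + 1 , t , (*-monoʳ-≤ 2 1≤t , m≤m+n (2 * t) 1 , colour′ , proper′) , bound
  where
  open Colourings t
  open Colouring φ
  range : ∀ v → colour v < 2 * t + 1
  range v = subst (colour v <_) (arrange t) (s≤s (in-range v))
    where
    arrange : ∀ t → suc (t + t) ≡ 2 * t + 1
    arrange = solve-∀
  colour′ : Fin (n G) → Fin (2 * t + 1)
  colour′ v = fromℕ< (range v)
  proper′ : IsPQColoring G (2 * t + 1) t colour′
  proper′ u v uv rewrite Fin.toℕ-fromℕ< (range u) | Fin.toℕ-fromℕ< (range v) = far , near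
    where open _~_ (proper u v uv)

mainTheorem2 : (t : ℕ) → 1 ≤ t → (G : Graph) →
    OddGirth≥ G (2 * t + 1) →
    MadLt G (2 * (3 * t ∸ 2) + 1) (3 * t ∸ 2) →
    ChiCLe G (2 * t + 1) t
mainTheorem2 (suc t′) 1≤t G girth mad =
  circular-colouring-bound 1≤t G (colourable t′ G girth mad (n G) G ≤-refl (⊆-refl G))
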